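{- Let $M$ be a positroid on $[n]$ without coloops and let $k\le n$, $r$ be nonnegative integers. If $\operatorname{cw}_M(A)\leq r$ for all $k$-element subsets $A\subseteq[n]$, then $\operatorname{cw}_M(A)\leq|A|-k+r$ for all $A\subseteq[n]$ with $|A|\geq k$.
   Context: For $i\in[n]$ the cyclic order $<_i$ is $i<_i i+1<_i\cdots<_i n<_i 1<_i\cdots<_i i-1$. A decorated permutation on $[n]$ is $(\pi,\operatorname{col})$, $\pi$ a permutation of $[n]$, $\operatorname{col}:[n]\to\{0,1,-1\}$ with $\operatorname{col}(i)=0$ iff $\pi(i)\neq i$; each positroid $M$ on $[n]$ corresponds to a unique decorated permutation (its bases are the sets $B$ with $I_i\le_i B$ in Gale order for all $i$, where $I_i=\{j: j<_i\pi^{ -1}(j)\text{ or }\operatorname{col}(j)=-1\}$), and coloops of $M$ are the $i$ with $\pi(i)=i$, $\operatorname{col}(i)=-1$. The CW-arrow starting at $i$ is $C_i=[n]$ if $\pi(i)=i$ and $\operatorname{col}(i)=-1$, and otherwise $C_i=\{j: j\leq_i\pi(i)\}$. The CW-function is $\operatorname{cw}_M(A)=|\{i: C_i\subseteq A\}|$ for $A\neq[n]$, and $\operatorname{cw}_M([n])=n-\operatorname{rk}_M([n])$. -}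

module Defs where

open import Data.Nat using (ℕ; zero; suc; _+_; _∸_; _≤_; _<_; _≤ᵇ_; _<ᵇ_)
open import Data.Bool using (Bool; true; false; if_then_else_; _∨_)
import Data.Bool as Bool
open import Data.Fin using (Fin; toℕ) renaming (zero to fzero)
import Data.Fin as Fin
open import Data.Fin.Subset using (Subset; ⊤; ∣_∣; _⊆_)
open import Data.Fin.Subset.Properties using (_⊆?_)
open import Data.Fin.Permutation using (Permutation′; _⟨$⟩ʳ_; _⟨$⟩ˡ_)
open import Data.Vec using (tabulate)
open import Data.Vec.Properties using (≡-dec)
open import Data.Product using (_×_)
open import Relation.Nullary using (¬_; does)
open import Relation.Binary.PropositionalEquality using (_≡_; _≢_)

data Col : Set where
  c0 c+ c- : Col

isMinus : Col → Bool
isMinus c- = true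
isMinus _  = false

-- A decorated permutation on [n] (elements of [n] are Fin n; element i+1 of
-- the paper is Fin-element i).  Each positroid corresponds to exactly one.
record DecPerm (n : ℕ) : Set where
  field
    π      : Permutation′ n
    col    : Fin n → Col
    col-ok : ∀ i → (col i ≡ c0 → π ⟨$⟩ʳ i ≢ i) × (π ⟨$⟩ʳ i ≢ i → col i ≡ c0)
open DecPerm public

-- position of j in the cyclic order <_i  (i has position 0)
offset : {n : ℕ} → Fin n → Fin n → ℕ
offset {n} i j = if toℕ i ≤ᵇ toℕ j then toℕ j ∸ toℕ i else (n ∸ toℕ i) + toℕ j

leqᵇ : {n : ℕ} → Fin n → Fin n → Fin n → Bool
leqᵇ i j l = offset i j ≤ᵇ offset i l

ltᵇ : {n : ℕ} → Fin n → Fin n → Fin n → Bool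
ltᵇ i j l = offset i j <ᵇ offset i l

sizeAtFirst : {n : ℕ} → (Fin n → Subset n) → ℕ
sizeAtFirst {zero}  X = 0
sizeAtFirst {suc m} X = ∣ X fzero ∣

module _ {n : ℕ} (M : DecPerm n) where

  πM : Fin n → Fin n
  πM i = π M ⟨$⟩ʳ i

  π⁻¹M : Fin n → Fin n
  π⁻¹M j = π M ⟨$⟩ˡ j

  IsColoop : Fin n → Set
  IsColoop i = (πM i ≡ i) × (col M i ≡ c-)

  NoColoops : Set
  NoColoops = ∀ i → ¬ IsColoop i

  I : Fin n → Subset n
  I i = tabulate (λ j → ltᵇ i j (π⁻¹M j) ∨ isMinus (col M j))

  -- rank of the positroid = size of any basis = |I_1| (I_1 is a basis);
  -- for n = 0 the rank is 0.
  rkTotal : ℕ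
  rkTotal = sizeAtFirst I

  C : Fin n → Subset n
  C i = if isColoopᵇ then ⊤ else tabulate (λ j → leqᵇ i j (πM i))
    where
      isColoopᵇ : Bool
      isColoopᵇ = does (Fin._≟_ (πM i) i) Data.Bool.∧ isMinus (col M i)

  cw : Subset n → ℕ
  cw A = if does (≡-dec Bool._≟_ A ⊤)
           then n ∸ rkTotal
           else ∣ tabulate (λ i → does (C i ⊆? A)) ∣

{-# OPTIONS --safe #-}

-- Removing a well-chosen element of A lowers cw_M(A) by at most one, so induction on
-- |A| - k gives the bound.  Without coloops every arrow C_i is the cyclic interval from i
-- to π(i).  If A ≠ [n], take e ∈ A whose cyclic successor is not in A: an arrow inside A
-- that contains e cannot continue past e, so it ends at e, and only the arrow starting at
-- π⁻¹(e) is lost.  For A = [n], remove 1: cw_M([n]) = n - |I₁| counts the i with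
-- i ≤ π(i) (π⁻¹(I₁) is the set of the others), and for such i ≠ 1 the arrow C_i misses 1.

module Submission where

open import Data.Bool.Base using (Bool; true; false; T; if_then_else_; _∨_)
import Data.Bool.Properties as Bool
open import Data.Fin.Base using (Fin; zero; suc; toℕ; fromℕ; inject₁; lower₁)
import Data.Fin.Properties as Fin
open import Data.Fin.Induction using (<-weakInduction; <-weakInduction-startingFrom)
open import Data.Fin.Permutation using (Permutation′; _⟨$⟩ʳ_; inverseˡ)
open import Data.Fin.Subset
  using (Subset; inside; outside; _∈_; _∉_; _⊆_; _∪_; _-_; ⁅_⁆; ∁; ⊤; ∣_∣; Nonempty)
open import Data.Fin.Subset.Properties
  using (_∈?_; _⊆?_; ∈⊤; ⊆⊤; ⊆-antisym; x∈⁅x⁆; ∣⁅x⁆∣≡1; x∈p∪q⁺; x∈p∧x≢y⇒x∈p-y;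
         x∈p⇒∣p-x∣<∣p∣; p⊆q⇒∣p∣≤∣q∣; x∈∁p⇒x∉p; ∣∁p∣≡n∸∣p∣; nonempty?; Empty-unique; ∣⊥∣≡0)
open import Data.Nat.Base
  using (ℕ; zero; suc; _+_; _∸_; _≤_; _<_; _≤ᵇ_; z≤n; s≤s; z<s; s<s⁻¹)
open import Data.Nat.Properties
  using (+-0-commutativeMonoid; _≟_; _≤?_; ≤-antisym; ≤-trans; ≤-reflexive; ≤-<-trans;
         <⇒≤; <⇒≢; <⇒≱; ≰⇒>; ≤∧≢⇒<; n≤1+n; n≢0⇒n>0; m≤m+n; m≤n+m; m+n≮n; m∸n+n≡m;
         +-comm; +-assoc; +-suc; +-cancelʳ-≡; +-cancelʳ-≤; +-cancelʳ-<; +-monoʳ-≤; +-monoˡ-<;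
         +-mono-<-≤; suc-injective; ≤ᵇ⇒≤; ≤⇒≤ᵇ; ≤ᵇ-reflects-≤; <⇒<ᵇ; module ≤-Reasoning)
open import Algebra.Properties.CommutativeMonoid.Sum +-0-commutativeMonoid using (sum; sum-permute)
open import Data.Product.Base using (∃; _×_; _,_)
open import Data.Sum.Base using (_⊎_; inj₁; inj₂)
open import Data.Vec.Base using (_∷_; []; tabulate; lookup; there)
open import Data.Vec.Properties using (≡-dec; lookup∘tabulate; tabulate∘lookup; lookup⇒[]=; []=⇒lookup)
open import Function.Base using (_∘_)
open import Function.Bundles using (module Equivalence)
open import Relation.Nullary using (Dec; yes; no; does; contradiction)
open import Relation.Nullary.Decidable using (dec-true; dec-false; decidable-stable; _×-dec_; ¬?)
open import Relation.Nullary.Reflects using (ofʸ; ofⁿ)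
open import Relation.Binary.PropositionalEquality
  using (_≡_; _≢_; refl; sym; trans; cong; subst; subst₂; module ≡-Reasoning)

open import Defs

private
  variable
    m n : ℕ
    p q : Subset n
    x y : Fin n

∈-tabulate⁺ : {f : Fin n → Bool} → T (f x) → x ∈ tabulate f
∈-tabulate⁺ {x = x} {f} fx =
  lookup⇒[]= x (tabulate f) (trans (lookup∘tabulate f x) (Equivalence.to Bool.T-≡ fx))

∈-tabulate⁻ : {f : Fin n → Bool} → x ∈ tabulate f → T (f x)
∈-tabulate⁻ {x = x} {f} x∈ =
  Equivalence.from Bool.T-≡ (trans (sym (lookup∘tabulate f x)) ([]=⇒lookup x∈))

0<∣p∣⇒Nonempty : {p : Subset n} → 0 < ∣ p ∣ → Nonempty p
0<∣p∣⇒Nonempty {n = n} {p = p} 0<∣p∣ with nonempty? p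
... | yes p≢∅ = p≢∅
... | no p≡∅ = contradiction (sym (trans (cong ∣_∣ (Empty-unique p≡∅)) (∣⊥∣≡0 n))) (<⇒≢ 0<∣p∣)

x∉p-x : (p : Subset n) (x : Fin n) → x ∉ p - x
x∉p-x (_ ∷ _) zero ()
x∉p-x (_ ∷ p) (suc x) (there x∈p-x) = x∉p-x p x x∈p-x

p-x≢⊤ : (p : Subset n) (x : Fin n) → p - x ≢ ⊤
p-x≢⊤ p x p-x≡⊤ = x∉p-x p x (subst (x ∈_) (sym p-x≡⊤) ∈⊤)

p⊆q∧x∉p⇒p⊆q-x : p ⊆ q → x ∉ p → p ⊆ q - x
p⊆q∧x∉p⇒p⊆q-x p⊆q x∉p y∈p = x∈p∧x≢y⇒x∈p-y (p⊆q y∈p) λ { refl → x∉p y∈p }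

∣p∪q∣≤∣p∣+∣q∣ : (p q : Subset n) → ∣ p ∪ q ∣ ≤ ∣ p ∣ + ∣ q ∣
∣p∪q∣≤∣p∣+∣q∣ []            []            = z≤n
∣p∪q∣≤∣p∣+∣q∣ (inside  ∷ p) (inside  ∷ q) =
  s≤s (≤-trans (∣p∪q∣≤∣p∣+∣q∣ p q) (+-monoʳ-≤ ∣ p ∣ (n≤1+n ∣ q ∣)))
∣p∪q∣≤∣p∣+∣q∣ (inside  ∷ p) (outside ∷ q) = s≤s (∣p∪q∣≤∣p∣+∣q∣ p q)
∣p∪q∣≤∣p∣+∣q∣ (outside ∷ p) (inside  ∷ q) =
  ≤-trans (s≤s (∣p∪q∣≤∣p∣+∣q∣ p q)) (≤-reflexive (sym (+-suc ∣ p ∣ ∣ q ∣)))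
∣p∪q∣≤∣p∣+∣q∣ (outside ∷ p) (outside ∷ q) = ∣p∪q∣≤∣p∣+∣q∣ p q

p⊆q∪⁅x⁆⇒∣p∣≤1+∣q∣ : p ⊆ q ∪ ⁅ x ⁆ → ∣ p ∣ ≤ suc ∣ q ∣
p⊆q∪⁅x⁆⇒∣p∣≤1+∣q∣ {p = p} {q} {x} p⊆q∪x = begin
  ∣ p ∣               ≤⟨ p⊆q⇒∣p∣≤∣q∣ p⊆q∪x ⟩
  ∣ q ∪ ⁅ x ⁆ ∣       ≤⟨ ∣p∪q∣≤∣p∣+∣q∣ q ⁅ x ⁆ ⟩
  ∣ q ∣ + ∣ ⁅ x ⁆ ∣   ≡⟨ cong (∣ q ∣ +_) (∣⁅x⁆∣≡1 x) ⟩
  ∣ q ∣ + 1           ≡⟨ +-comm ∣ q ∣ 1 ⟩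
  suc ∣ q ∣           ∎
  where open ≤-Reasoning

x∈p⇒1+∣p-x∣≡∣p∣ : x ∈ p → suc ∣ p - x ∣ ≡ ∣ p ∣
x∈p⇒1+∣p-x∣≡∣p∣ {x = x} {p} x∈p =
  ≤-antisym (x∈p⇒∣p-x∣<∣p∣ x∈p) (p⊆q∪⁅x⁆⇒∣p∣≤1+∣q∣ p⊆p-x∪x)
  where
  p⊆p-x∪x : p ⊆ (p - x) ∪ ⁅ x ⁆
  p⊆p-x∪x {y} y∈p with y Fin.≟ x
  ... | yes refl = x∈p∪q⁺ (inj₂ (x∈⁅x⁆ x))
  ... | no y≢x = x∈p∪q⁺ (inj₁ (x∈p∧x≢y⇒x∈p-y y∈p y≢x))

∣tabulate∣≡sum : (f : Fin n → Bool) → ∣ tabulate f ∣ ≡ sum (λ i → if f i then 1 else 0)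
∣tabulate∣≡sum {zero}  f = refl
∣tabulate∣≡sum {suc n} f with f zero
... | true  = cong suc (∣tabulate∣≡sum (f ∘ suc))
... | false = ∣tabulate∣≡sum (f ∘ suc)

preimage : Permutation′ n → Subset n → Subset n
preimage σ p = tabulate (λ i → lookup p (σ ⟨$⟩ʳ i))

∈-preimage⁺ : (σ : Permutation′ n) (p : Subset n) → σ ⟨$⟩ʳ x ∈ p → x ∈ preimage σ p
∈-preimage⁺ σ p σx∈p = ∈-tabulate⁺ (Equivalence.from Bool.T-≡ ([]=⇒lookup σx∈p))

∣preimage∣ : (σ : Permutation′ n) (p : Subset n) → ∣ preimage σ p ∣ ≡ ∣ p ∣
∣preimage∣ σ p = begin
  ∣ preimage σ p ∣                ≡⟨ ∣tabulate∣≡sum (lookup p ∘ (σ ⟨$⟩ʳ_)) ⟩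
  sum (χ ∘ lookup p ∘ (σ ⟨$⟩ʳ_))  ≡⟨ sym (sum-permute (χ ∘ lookup p) σ) ⟩
  sum (χ ∘ lookup p)              ≡⟨ sym (∣tabulate∣≡sum (lookup p)) ⟩
  ∣ tabulate (lookup p) ∣         ≡⟨ cong ∣_∣ (tabulate∘lookup p) ⟩
  ∣ p ∣                           ∎
  where
  open ≡-Reasoning
  χ : Bool → ℕ
  χ b = if b then 1 else 0

Peelable : (Subset n → ℕ) → Set
Peelable f = ∀ A → Nonempty A → ∃ λ e → e ∈ A × f A ≤ suc (f (A - e))

peel-bound : {f : Subset n → ℕ} → Peelable f → {k r : ℕ} →
             (∀ A → ∣ A ∣ ≡ k → f A ≤ r) →
             ∀ d A → ∣ A ∣ ≡ d + k → f A ≤ d + r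
peel-bound peel level zero    A ∣A∣≡k = level A ∣A∣≡k
peel-bound {f = f} peel {k} {r} level (suc d) A ∣A∣≡1+d+k
  with peel A (0<∣p∣⇒Nonempty (subst (0 <_) (sym ∣A∣≡1+d+k) z<s))
... | e , e∈A , fA≤1+fA-e = begin
  f A              ≤⟨ fA≤1+fA-e ⟩
  suc (f (A - e))  ≤⟨ s≤s (peel-bound peel level d (A - e) ∣A-e∣≡d+k) ⟩
  suc (d + r)      ∎
  where
  open ≤-Reasoning
  ∣A-e∣≡d+k : ∣ A - e ∣ ≡ d + k
  ∣A-e∣≡d+k = suc-injective (trans (x∈p⇒1+∣p-x∣≡∣p∣ e∈A) ∣A∣≡1+d+k)

next : Fin (suc m) → Fin (suc m)
next {m} x with m ≟ toℕ x
... | yes _   = zero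
... | no m≢x = suc (lower₁ x m≢x)

next-inject₁ : (x : Fin m) → next (inject₁ x) ≡ suc x
next-inject₁ {m} x with m ≟ toℕ (inject₁ x)
... | yes m≡x = contradiction m≡x (Fin.toℕ-inject₁-≢ x)
... | no m≢x  = cong suc (Fin.lower₁-inject₁′ x m≢x)

next-fromℕ : next (fromℕ m) ≡ zero
next-fromℕ {m} with m ≟ toℕ (fromℕ m)
... | yes _   = refl
... | no m≢m = contradiction (sym (Fin.toℕ-fromℕ m)) m≢m

toℕ-next : (x : Fin (suc m)) → (toℕ x ≡ m × next x ≡ zero) ⊎ toℕ (next x) ≡ suc (toℕ x)
toℕ-next {m} x with m ≟ toℕ x
... | yes m≡x = inj₁ (sym m≡x , refl)
... | no m≢x  = inj₂ (cong suc (Fin.toℕ-lower₁ x m≢x))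

next-closed⇒⊤ : {A : Subset (suc m)} → (∀ {x} → x ∈ A → next x ∈ A) → y ∈ A → A ≡ ⊤
next-closed⇒⊤ {m} {y = y} {A} closed y∈A =
  ⊆-antisym ⊆⊤ (λ {x} _ → <-weakInduction (_∈ A) zero∈A step x)
  where
  step : ∀ x → inject₁ x ∈ A → suc x ∈ A
  step x x∈A = subst (_∈ A) (next-inject₁ x) (closed x∈A)
  zero∈A : zero ∈ A
  zero∈A = subst (_∈ A) next-fromℕ
    (closed (<-weakInduction-startingFrom (_∈ A) y∈A step (Fin.≤fromℕ y)))

∃-exit : {A : Subset (suc m)} → A ≢ ⊤ → Nonempty A → ∃ λ e → e ∈ A × next e ∉ A
∃-exit {A = A} A≢⊤ (y , y∈A) with Fin.any? (λ e → (e ∈? A) ×-dec ¬? (next e ∈? A))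
... | yes exit  = exit
... | no ¬exit = contradiction (next-closed⇒⊤ closed y∈A) A≢⊤
  where
  closed : ∀ {e} → e ∈ A → next e ∈ A
  closed {e} e∈A = decidable-stable (next e ∈? A) (λ next∉A → ¬exit (e , e∈A , next∉A))

offset-≤ : (x y : Fin n) → toℕ x ≤ toℕ y → offset x y + toℕ x ≡ toℕ y
offset-≤ x y x≤y with toℕ x ≤ᵇ toℕ y | ≤ᵇ-reflects-≤ (toℕ x) (toℕ y)
... | true  | _       = m∸n+n≡m x≤y
... | false | ofⁿ x≰y = contradiction x≤y x≰y

offset-> : (x y : Fin n) → toℕ y < toℕ x → offset x y + toℕ x ≡ toℕ y + n
offset-> {n} x y y<x with toℕ x ≤ᵇ toℕ y | ≤ᵇ-reflects-≤ (toℕ x) (toℕ y)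
... | true  | ofʸ x≤y = contradiction x≤y (<⇒≱ y<x)
... | false | _       = begin
  n ∸ toℕ x + toℕ y + toℕ x    ≡⟨ +-assoc (n ∸ toℕ x) (toℕ y) (toℕ x) ⟩
  n ∸ toℕ x + (toℕ y + toℕ x)  ≡⟨ cong (n ∸ toℕ x +_) (+-comm (toℕ y) (toℕ x)) ⟩
  n ∸ toℕ x + (toℕ x + toℕ y)  ≡⟨ sym (+-assoc (n ∸ toℕ x) (toℕ x) (toℕ y)) ⟩
  n ∸ toℕ x + toℕ x + toℕ y    ≡⟨ cong (_+ toℕ y) (m∸n+n≡m (<⇒≤ (Fin.toℕ<n x))) ⟩
  n + toℕ y                    ≡⟨ +-comm n (toℕ y) ⟩
  toℕ y + n                    ∎
  where open ≡-Reasoning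

offset-spec : (x y : Fin n) → offset x y + toℕ x ≡ toℕ y ⊎ offset x y + toℕ x ≡ toℕ y + n
offset-spec x y with toℕ x ≤? toℕ y
... | yes x≤y = inj₁ (offset-≤ x y x≤y)
... | no  x≰y = inj₂ (offset-> x y (≰⇒> x≰y))

offset<n : (x y : Fin n) → offset x y < n
offset<n {n} x y with toℕ x ≤? toℕ y
... | yes x≤y = ≤-<-trans (m≤m+n (offset x y) (toℕ x))
                          (subst (_< n) (sym (offset-≤ x y x≤y)) (Fin.toℕ<n y))
... | no  x≰y = +-cancelʳ-< (toℕ x) (offset x y) n (begin-strict
  offset x y + toℕ x  ≡⟨ offset-> x y (≰⇒> x≰y) ⟩
  toℕ y + n           <⟨ +-monoˡ-< n (≰⇒> x≰y) ⟩
  toℕ x + n           ≡⟨ +-comm (toℕ x) n ⟩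
  n + toℕ x           ∎)
  where open ≤-Reasoning

a+c≡x∧b+c≡x+n⇒n≤b : ∀ {a b c x} → a + c ≡ x → b + c ≡ x + n → n ≤ b
a+c≡x∧b+c≡x+n⇒n≤b {n} {a} {b} {c} {x} a+c≡x b+c≡x+n = +-cancelʳ-≤ c n b (begin
  n + c        ≤⟨ +-monoʳ-≤ n (m≤n+m c a) ⟩
  n + (a + c)  ≡⟨ +-comm n (a + c) ⟩
  a + c + n    ≡⟨ cong (_+ n) a+c≡x ⟩
  x + n        ≡⟨ sym b+c≡x+n ⟩
  b + c        ∎)
  where open ≤-Reasoning

offset-unique : (x y : Fin n) {d : ℕ} → d < n →
                d + toℕ x ≡ toℕ y ⊎ d + toℕ x ≡ toℕ y + n → offset x y ≡ d
offset-unique x y d<n d-spec with offset-spec x y | d-spec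
... | inj₁ o+x≡y   | inj₁ d+x≡y   = +-cancelʳ-≡ (toℕ x) _ _ (trans o+x≡y (sym d+x≡y))
... | inj₂ o+x≡y+n | inj₂ d+x≡y+n = +-cancelʳ-≡ (toℕ x) _ _ (trans o+x≡y+n (sym d+x≡y+n))
... | inj₁ o+x≡y   | inj₂ d+x≡y+n = contradiction (a+c≡x∧b+c≡x+n⇒n≤b o+x≡y d+x≡y+n) (<⇒≱ d<n)
... | inj₂ o+x≡y+n | inj₁ d+x≡y   =
  contradiction (a+c≡x∧b+c≡x+n⇒n≤b d+x≡y o+x≡y+n) (<⇒≱ (offset<n x y))

offset-injective : (x : Fin n) {y z : Fin n} → offset x y ≡ offset x z → y ≡ z
offset-injective {n} x {y} {z} oy≡oz = compare (offset-spec x y) (offset-spec x z)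
  where
  link : ∀ {a b} → offset x y + toℕ x ≡ a → offset x z + toℕ x ≡ b → a ≡ b
  link oy+x≡a oz+x≡b = trans (sym oy+x≡a) (trans (cong (_+ toℕ x) oy≡oz) oz+x≡b)
  compare : offset x y + toℕ x ≡ toℕ y ⊎ offset x y + toℕ x ≡ toℕ y + n →
            offset x z + toℕ x ≡ toℕ z ⊎ offset x z + toℕ x ≡ toℕ z + n → y ≡ z
  compare (inj₁ p) (inj₁ q) = Fin.toℕ-injective (link p q)
  compare (inj₂ p) (inj₂ q) = Fin.toℕ-injective (+-cancelʳ-≡ n _ _ (link p q))
  compare (inj₁ p) (inj₂ q) =
    contradiction (subst (_< n) (link p q) (Fin.toℕ<n y)) (m+n≮n (toℕ z) n)
  compare (inj₂ p) (inj₁ q) =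
    contradiction (subst (_< n) (sym (link p q)) (Fin.toℕ<n z)) (m+n≮n (toℕ y) n)

offset-next : (x y : Fin (suc m)) → suc (offset x y) < suc m → offset x (next y) ≡ suc (offset x y)
offset-next {m} x y 1+o<1+m = offset-unique x (next y) 1+o<1+m (step (offset-spec x y) (toℕ-next y))
  where
  o = offset x y
  step : o + toℕ x ≡ toℕ y ⊎ o + toℕ x ≡ toℕ y + suc m →
         (toℕ y ≡ m × next y ≡ zero) ⊎ toℕ (next y) ≡ suc (toℕ y) →
         suc o + toℕ x ≡ toℕ (next y) ⊎ suc o + toℕ x ≡ toℕ (next y) + suc m
  step (inj₁ o+x≡y)   (inj₂ next≡1+y) = inj₁ (trans (cong suc o+x≡y) (sym next≡1+y))
  step (inj₂ o+x≡y+n) (inj₂ next≡1+y) = inj₂ (trans (cong suc o+x≡y+n) (cong (_+ suc m) (sym next≡1+y)))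
  step (inj₁ o+x≡y)   (inj₁ (y≡m , next≡0)) =
    inj₂ (subst (λ z → suc o + toℕ x ≡ toℕ z + suc m) (sym next≡0) (cong suc (trans o+x≡y y≡m)))
  step (inj₂ o+x≡y+n) (inj₁ (y≡m , _)) =
    contradiction o+x≡y+n
      (<⇒≢ (+-mono-<-≤ (subst (o <_) (sym y≡m) (s<s⁻¹ 1+o<1+m)) (<⇒≤ (Fin.toℕ<n x))))

cyclicInterval : Fin n → Fin n → Subset n
cyclicInterval x z = tabulate (λ y → leqᵇ x y z)

∈cyclicInterval⁺ : (x : Fin n) {y z : Fin n} → offset x y ≤ offset x z → y ∈ cyclicInterval x z
∈cyclicInterval⁺ _ oy≤oz = ∈-tabulate⁺ (≤⇒≤ᵇ oy≤oz)

∈cyclicInterval⁻ : (x : Fin n) {y z : Fin n} → y ∈ cyclicInterval x z → offset x y ≤ offset x z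
∈cyclicInterval⁻ x {y} {z} y∈ = ≤ᵇ⇒≤ (offset x y) (offset x z) (∈-tabulate⁻ y∈)

cyclicInterval-next : {x y z : Fin (suc m)} →
                      y ∈ cyclicInterval x z → y ≢ z → next y ∈ cyclicInterval x z
cyclicInterval-next {x = x} {y} {z} y∈ y≢z = ∈cyclicInterval⁺ x (begin
  offset x (next y)  ≡⟨ offset-next x y (≤-<-trans oy<oz (offset<n x z)) ⟩
  suc (offset x y)   ≤⟨ oy<oz ⟩
  offset x z         ∎)
  where
  open ≤-Reasoning
  oy<oz : offset x y < offset x z
  oy<oz = ≤∧≢⇒< (∈cyclicInterval⁻ x y∈) (y≢z ∘ offset-injective x)

zero∈cyclicInterval⇒z<x : {x z : Fin (suc m)} → 0 < toℕ x → zero ∈ cyclicInterval x z → toℕ z < toℕ x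
zero∈cyclicInterval⇒z<x {m} {x} {z} 0<x zero∈ = ≰⇒> λ x≤z → <⇒≱ (oz<o0 x≤z) (∈cyclicInterval⁻ x zero∈)
  where
  oz<o0 : toℕ x ≤ toℕ z → offset x z < offset x zero
  oz<o0 x≤z = +-cancelʳ-< (toℕ x) _ _
    (subst₂ _<_ (sym (offset-≤ x z x≤z)) (sym (offset-> x zero 0<x)) (Fin.toℕ<n z))

module _ (M : DecPerm n) where

  arrowsIn : Subset n → Subset n
  arrowsIn A = tabulate (λ i → does (C M i ⊆? A))

  ∈arrowsIn⁺ : {A : Subset n} {i : Fin n} → C M i ⊆ A → i ∈ arrowsIn A
  ∈arrowsIn⁺ {A} {i} Cᵢ⊆A = ∈-tabulate⁺ (Equivalence.from Bool.T-≡ (dec-true (C M i ⊆? A) Cᵢ⊆A))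

  ∈arrowsIn⁻ : {A : Subset n} {i : Fin n} → i ∈ arrowsIn A → C M i ⊆ A
  ∈arrowsIn⁻ {A} {i} i∈ with C M i ⊆? A | ∈-tabulate⁻ {f = λ i → does (C M i ⊆? A)} i∈
  ... | yes Cᵢ⊆A | _ = Cᵢ⊆A

  cw≡∣arrowsIn∣ : {A : Subset n} → A ≢ ⊤ → cw M A ≡ ∣ arrowsIn A ∣
  cw≡∣arrowsIn∣ {A} A≢⊤ rewrite dec-false (≡-dec Bool._≟_ A ⊤) A≢⊤ = refl

  cw-⊤ : cw M ⊤ ≡ n ∸ rkTotal M
  cw-⊤ rewrite dec-true (≡-dec Bool._≟_ (⊤ {n = n}) ⊤) refl = refl

  C≡cyclicInterval : NoColoops M → (i : Fin n) → C M i ≡ cyclicInterval i (πM M i)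
  C≡cyclicInterval noColoops i with πM M i Fin.≟ i | col M i in colᵢ≡
  ... | yes πᵢ≡i | c- = contradiction (πᵢ≡i , colᵢ≡) (noColoops i)
  ... | yes _    | c0 = refl
  ... | yes _    | c+ = refl
  ... | no _     | _  = refl

module _ (M : DecPerm (suc m)) (noColoops : NoColoops M) where

  private
    Cᵢ≡ : (i : Fin (suc m)) → C M i ≡ cyclicInterval i (πM M i)
    Cᵢ≡ = C≡cyclicInterval M noColoops

  C-next : {i e : Fin (suc m)} → e ∈ C M i → e ≢ πM M i → next e ∈ C M i
  C-next {i} {e} e∈Cᵢ e≢πᵢ =
    subst (next e ∈_) (sym (Cᵢ≡ i)) (cyclicInterval-next {x = i} (subst (e ∈_) (Cᵢ≡ i) e∈Cᵢ) e≢πᵢ)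

  zero∈C⇒π<id : {i : Fin (suc m)} → i ≢ zero → zero ∈ C M i → toℕ (πM M i) < toℕ i
  zero∈C⇒π<id {i} i≢0 zero∈Cᵢ =
    zero∈cyclicInterval⇒z<x (n≢0⇒n>0 (i≢0 ∘ Fin.toℕ-injective)) (subst (zero ∈_) (Cᵢ≡ i) zero∈Cᵢ)

  arrow-ends-at-exit : {A : Subset (suc m)} {i e : Fin (suc m)} →
                       C M i ⊆ A → next e ∉ A → e ∈ C M i → πM M i ≡ e
  arrow-ends-at-exit {i = i} {e} Cᵢ⊆A next∉A e∈Cᵢ with πM M i Fin.≟ e
  ... | yes πᵢ≡e = πᵢ≡e
  ... | no πᵢ≢e = contradiction (Cᵢ⊆A (C-next e∈Cᵢ (πᵢ≢e ∘ sym))) next∉A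

  arrowsIn-exit : {A : Subset (suc m)} {e : Fin (suc m)} →
                  next e ∉ A → arrowsIn M A ⊆ arrowsIn M (A - e) ∪ ⁅ π⁻¹M M e ⁆
  arrowsIn-exit {A} {e} next∉A {i} i∈ with e ∈? C M i
  ... | no e∉Cᵢ  = x∈p∪q⁺ (inj₁ (∈arrowsIn⁺ M (p⊆q∧x∉p⇒p⊆q-x (∈arrowsIn⁻ M i∈) e∉Cᵢ)))
  ... | yes e∈Cᵢ = x∈p∪q⁺ (inj₂ (subst (λ j → i ∈ ⁅ j ⁆) (sym π⁻¹e≡i) (x∈⁅x⁆ i)))
    where
    π⁻¹e≡i : π⁻¹M M e ≡ i
    π⁻¹e≡i = trans (cong (π⁻¹M M) (sym (arrow-ends-at-exit (∈arrowsIn⁻ M i∈) next∉A e∈Cᵢ)))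
                   (inverseˡ (π M))

  cw-exit : {A : Subset (suc m)} {e : Fin (suc m)} → A ≢ ⊤ → next e ∉ A → cw M A ≤ suc (cw M (A - e))
  cw-exit {A} {e} A≢⊤ next∉A = begin
    cw M A                       ≡⟨ cw≡∣arrowsIn∣ M A≢⊤ ⟩
    ∣ arrowsIn M A ∣             ≤⟨ p⊆q∪⁅x⁆⇒∣p∣≤1+∣q∣ {q = arrowsIn M (A - e)} (arrowsIn-exit next∉A) ⟩
    suc ∣ arrowsIn M (A - e) ∣   ≡⟨ cong suc (sym (cw≡∣arrowsIn∣ M (p-x≢⊤ A e))) ⟩
    suc (cw M (A - e))           ∎
    where open ≤-Reasoning

  ∈I₁⁺ : {j : Fin (suc m)} → toℕ j < toℕ (π⁻¹M M j) → j ∈ I M zero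
  ∈I₁⁺ {j} j<π⁻¹j =
    ∈-tabulate⁺ {f = λ j → ltᵇ zero j (π⁻¹M M j) ∨ isMinus (col M j)}
                (Equivalence.from Bool.T-∨ (inj₁ (<⇒<ᵇ j<π⁻¹j)))

  π<id⇒∈π⁻¹I₁ : {i : Fin (suc m)} → toℕ (πM M i) < toℕ i → i ∈ preimage (π M) (I M zero)
  π<id⇒∈π⁻¹I₁ {i} πᵢ<i =
    ∈-preimage⁺ (π M) (I M zero)
      (∈I₁⁺ (subst (λ j → toℕ (πM M i) < toℕ j) (sym (inverseˡ (π M))) πᵢ<i))

  cw-⊤≤ : cw M ⊤ ≤ suc (cw M (⊤ - zero))
  cw-⊤≤ = begin
    cw M ⊤                            ≡⟨ cw-⊤ M ⟩
    suc m ∸ ∣ I M zero ∣              ≡⟨ cong (suc m ∸_) (sym (∣preimage∣ (π M) (I M zero))) ⟩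
    suc m ∸ ∣ π⁻¹I₁ ∣                 ≡⟨ sym (∣∁p∣≡n∸∣p∣ π⁻¹I₁) ⟩
    ∣ ∁ π⁻¹I₁ ∣                       ≤⟨ p⊆q∪⁅x⁆⇒∣p∣≤1+∣q∣ {q = arrowsIn M (⊤ - zero)} {x = zero} ∁π⁻¹I₁⊆ ⟩
    suc ∣ arrowsIn M (⊤ - zero) ∣     ≡⟨ cong suc (sym (cw≡∣arrowsIn∣ M (p-x≢⊤ ⊤ zero))) ⟩
    suc (cw M (⊤ - zero))             ∎
    where
    open ≤-Reasoning
    π⁻¹I₁ : Subset (suc m)
    π⁻¹I₁ = preimage (π M) (I M zero)
    ∁π⁻¹I₁⊆ : ∁ π⁻¹I₁ ⊆ arrowsIn M (⊤ - zero) ∪ ⁅ zero ⁆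
    ∁π⁻¹I₁⊆ {i} i∈∁ with i Fin.≟ zero | zero ∈? C M i
    ... | yes refl | _           = x∈p∪q⁺ (inj₂ (x∈⁅x⁆ zero))
    ... | no _     | no zero∉Cᵢ  = x∈p∪q⁺ (inj₁ (∈arrowsIn⁺ M (p⊆q∧x∉p⇒p⊆q-x ⊆⊤ zero∉Cᵢ)))
    ... | no i≢0   | yes zero∈Cᵢ = contradiction (π<id⇒∈π⁻¹I₁ (zero∈C⇒π<id i≢0 zero∈Cᵢ)) (x∈∁p⇒x∉p i∈∁)

cw-peelable : (M : DecPerm n) → NoColoops M → Peelable (cw M)
cw-peelable {zero}  M noColoops A (() , _)
cw-peelable {suc m} M noColoops A = peel (≡-dec Bool._≟_ A ⊤)
  where
  -- Not a `with`: that would also abstract the same decision inside `cw M A`.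
  peel : Dec (A ≡ ⊤) → Nonempty A → ∃ λ e → e ∈ A × cw M A ≤ suc (cw M (A - e))
  peel (yes refl) _ = zero , ∈⊤ , cw-⊤≤ M noColoops
  peel (no A≢⊤) A≢∅ with ∃-exit A≢⊤ A≢∅
  ... | e , e∈A , next∉A = e , e∈A , cw-exit M noColoops A≢⊤ next∉A

corollary4p15 : (n : ℕ) (M : DecPerm n) → NoColoops M →
    (k r : ℕ) → k ≤ n →
    ((A : Subset n) → ∣ A ∣ ≡ k → cw M A ≤ r) →
    (A : Subset n) → k ≤ ∣ A ∣ → cw M A ≤ (∣ A ∣ ∸ k) + r
corollary4p15 n M noColoops k r _ level A k≤∣A∣ =
  peel-bound (cw-peelable M noColoops) level (∣ A ∣ ∸ k) A (sym (m∸n+n≡m k≤∣A∣))
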